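{- Let $f$ be a non-negative monotone submodular function and $C>1$. The MSbM Algorithm (described in the context) run with $q=1$ and parameter $C$ outputs a $b$-matching $M$ satisfying $$\left(2C+\frac{C}{C-1}\right)f(M)\ge f(OPT),$$ where $OPT$ is a maximum-value $b$-matching. Taking $C=1+\frac{1}{\sqrt2}$ this gives a $(3+2\sqrt2)\approx5.828$ approximation.
   Context: Setting: $G=(V,E)$ is a graph, $b\in\mathbb{Z}_{>0}^V$, and $f:2^E\to\mathbb{R}_{\ge0}$ is given by a value oracle. A $b$-matching is a set of edges in which each vertex $v$ has degree at most $b_v$. Edges arrive in a stream $e^{(1)},\dots,e^{(|E|)}$; write $e<e'$ if $e$ arrives before $e'$. Let $f_S(e)=f(S\cup\{e\})-f(S)$ and $f(e:S)=f_{S\cap\{e'<e\}}(e)$. MSbM Algorithm with parameters $C>0$, $q\in[0,1]$: Initialize an empty stack $S$ and potentials $\phi_v^{(0)}=0$. For $t=1,\dots,|E|$: let $e=e^{(t)}$ and set $\phi^{(t)}_v=\phi^{(t-1)}_v$ for all $v$. If $C\sum_{v\in e}\phi^{(t-1)}_v\ge f(e:S)$, skip $e$. Otherwise, with probability $q$, push $e$ onto $S$ and for each $v\in e$ set $w_{ev}=\big(f(e:S)-\sum_{u\in e}\phi^{(t-1)}_u\big)/b_v$ and $\phi^{(t)}_v=\phi^{(t-1)}_v+w_{ev}$. Post-processing: set $M=\emptyset$; pop the edges of $S$ (last pushed first), adding a popped edge $e$ to $M$ if every $v\in e$ has fewer than $b_v$ edges of $M$ incident to it. Output $M$. -}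

module Defs where

open import Level using (0ℓ)
open import Data.Bool using (Bool; true; false; _∧_; _∨_; if_then_else_)
open import Data.Nat as ℕ using (ℕ; zero; suc; _<ᵇ_)
open import Data.Fin using (Fin; _≟_; _<_)
open import Data.Fin.Subset using (Subset; ⁅_⁆; _∪_; _∩_; _⊆_; _∈_; ∣_∣; ⊥)
open import Data.Product using (_×_; _,_; proj₁; proj₂)
open import Data.List using (List; []; _∷_; allFin)
open import Data.Vec using (tabulate)
open import Relation.Nullary using (¬_; ⌊_⌋)
open import Relation.Binary.Core using (Rel)
open import Relation.Binary.Structures using (IsTotalOrder)
open import Relation.Binary.PropositionalEquality using (_≡_)
open import Algebra.Core using (Op₁; Op₂)
open import Algebra.Structures using (IsCommutativeRing)

-- An ordered field (the real numbers are the intended instance; the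
-- algorithm and the guarantee only use ordered-field operations).

record OrderedField : Set₁ where
  infixl 7 _*_
  infixl 6 _+_ _-_
  infix 4 _≈_ _≤_
  field
    Carrier : Set
    _≈_ : Rel Carrier 0ℓ
    _+_ _*_ : Op₂ Carrier
    -_ : Op₁ Carrier
    0# 1# : Carrier
    isCommutativeRing : IsCommutativeRing _≈_ _+_ _*_ -_ 0# 1#
    _⁻¹ : Op₁ Carrier
    ⁻¹-inverse : ∀ x → ¬ (x ≈ 0#) → x * (x ⁻¹) ≈ 1#
    0≉1 : ¬ (0# ≈ 1#)
    _≤_ : Rel Carrier 0ℓ
    isTotalOrder : IsTotalOrder _≈_ _≤_
    +-mono-≤ : ∀ {x y} z → x ≤ y → x + z ≤ y + z
    *-nonneg : ∀ {x y} → 0# ≤ x → 0# ≤ y → 0# ≤ x * y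

  _-_ : Op₂ Carrier
  x - y = x + (- y)

  _<ᶠ_ : Rel Carrier 0ℓ
  x <ᶠ y = (x ≤ y) × ¬ (x ≈ y)

  fromℕ : ℕ → Carrier
  fromℕ zero = 0#
  fromℕ (suc k) = 1# + fromℕ k

-- Graphs: vertices Fin n, edges Fin m; edge e has endpoints ends e.
-- Edges are indexed in stream order: e arrives before e' iff e < e'.

module Graph {n m : ℕ} (ends : Fin m → Fin n × Fin n) where

  incident : Fin m → Fin n → Bool
  incident e v = ⌊ v ≟ proj₁ (ends e) ⌋ ∨ ⌊ v ≟ proj₂ (ends e) ⌋

  deg : Subset m → Fin n → ℕ
  deg M v = ∣ M ∩ tabulate (λ e → incident e v) ∣

  IsBMatching : (b : Fin n → ℕ) → Subset m → Set
  IsBMatching b M = ∀ v → deg M v ℕ.≤ b v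

  before : Fin m → Subset m
  before e = tabulate (λ e' → ⌊ e' Data.Fin.<? e ⌋)

  -- stack as a list of edges, top first; its underlying set
  toSet : List (Fin m) → Subset m
  toSet [] = ⊥
  toSet (e ∷ es) = ⁅ e ⁆ ∪ toSet es

  postProcess : (b : Fin n → ℕ) → List (Fin m) → Subset m → Subset m
  postProcess b [] M = M
  postProcess b (e ∷ es) M =
    postProcess b es
      (if (deg M (proj₁ (ends e)) <ᵇ b (proj₁ (ends e)))
          ∧ (deg M (proj₂ (ends e)) <ᵇ b (proj₂ (ends e)))
       then M ∪ ⁅ e ⁆ else M)

  IsSimpleGraph : Set
  IsSimpleGraph =
    (∀ e → ¬ (proj₁ (ends e) ≡ proj₂ (ends e))) ×
    (∀ e e' → ((ends e ≡ ends e') ⊎' (ends e ≡ swap (ends e'))) → e ≡ e')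
    where
      open import Data.Sum using () renaming (_⊎_ to _⊎'_)
      open import Data.Product using (swap)

module SetFunctions (F : OrderedField) {m : ℕ} (f : Subset m → OrderedField.Carrier F) where
  open OrderedField F

  NonNegative : Set
  NonNegative = ∀ A → 0# ≤ f A

  Monotone : Set
  Monotone = ∀ A B → A ⊆ B → f A ≤ f B

  Submodular : Set
  Submodular = ∀ A B → f (A ∪ B) + f (A ∩ B) ≤ f A + f B

  marginal : Subset m → Fin m → Carrier
  marginal S e = f (S ∪ ⁅ e ⁆) - f S

-- The MSbM algorithm with q = 1 (deterministic), as a relation
-- "processing the stream es from stack S and potentials φ ends in
-- stack S' and potentials φ'".

module MSbM (F : OrderedField) {n m : ℕ} (ends : Fin m → Fin n × Fin n)
            (b : Fin n → ℕ) (f : Subset m → OrderedField.Carrier F)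
            (C : OrderedField.Carrier F) where
  open OrderedField F
  open Graph ends
  open SetFunctions F f

  Potentials : Set
  Potentials = Fin n → Carrier

  gain : Fin m → List (Fin m) → Carrier
  gain e S = marginal (toSet S ∩ before e) e

  φsum : Potentials → Fin m → Carrier
  φsum φ e = φ (proj₁ (ends e)) + φ (proj₂ (ends e))

  update : Potentials → Fin m → List (Fin m) → Potentials
  update φ e S v =
    if incident e v
      then φ v + (gain e S - φsum φ e) * (fromℕ (b v)) ⁻¹
      else φ v

  data Process : List (Fin m) → List (Fin m) → Potentials
               → List (Fin m) → Potentials → Set where
    done : ∀ {S φ} → Process [] S φ S φ
    skip : ∀ {e es S φ S' φ'} →
           gain e S ≤ C * φsum φ e →
           Process es S φ S' φ' →
           Process (e ∷ es) S φ S' φ'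
    push : ∀ {e es S φ S' φ'} →
           ¬ (gain e S ≤ C * φsum φ e) →
           Process es (e ∷ S) (update φ e S) S' φ' →
           Process (e ∷ es) S φ S' φ'

  Run : List (Fin m) → Potentials → Set
  Run S φ = Process (allFin m) [] (λ _ → 0#) S φ

  output : List (Fin m) → Subset m
  output S = postProcess b S ⊥

  IsMaxBMatching : Subset m → Set
  IsMaxBMatching O = IsBMatching b O × (∀ M → IsBMatching b M → f M ≤ f O)

-- Let S be the final stack, φ the potentials it induces, M the output and
-- D the total excess of S, where excess(e) = f(e:S) − (φ_u + φ_w) is what
-- a pushed edge e = uw gains beyond its endpoint potentials.  Then
--   (1) f(S) ≤ f(∅) + C/(C−1)·D, as a pushed edge has f(e:S) > C(φ_u + φ_w);
--   (2) Σ_v b_v φ_v = 2D, as a push adds excess/b_v at both endpoints;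
--   (3) f(OPT) ≤ f(S) + C·Σ_v b_v φ_v, as every streamed edge has
--       f_S(e) ≤ C(φ_u + φ_w) and OPT has at most b_v edges at v;
--   (4) D ≤ Σ_{e ∈ S ∩ M} f(e:S) ≤ f(M) − f(∅), as popping charges the
--       excess of a rejected edge to one of its saturated endpoints.
-- Hence f(OPT) ≤ f(∅) + (2C + C/(C−1))·D ≤ (2C + C/(C−1))·f(M).

module Submission where

open import Defs
open import Data.Nat using (ℕ; _<_)
open import Data.Fin using (Fin)
open import Data.Fin.Subset using (Subset)
open import Data.Product using (_×_)
open import Data.List using (List)

open import Algebra.Bundles using (CommutativeRing)
import Algebra.Properties.Ring as RingProperties
import Algebra.Properties.Semiring.Sum as SemiringSum
import Algebra.Solver.CommutativeMonoid as CommutativeMonoidSolver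
open import Data.Bool using (Bool; true; false; _∧_; _∨_; if_then_else_; T)
import Data.Bool.Properties as BoolProperties
open import Data.Empty using (⊥-elim)
import Data.Fin as Fin
import Data.Fin.Properties as FinProperties
open import Data.Nat as ℕ using (zero; suc; _<ᵇ_)
import Data.Nat.Properties as ℕProperties
open import Data.Fin.Subset using (⁅_⁆; _∪_; _∩_; _⊆_; _∈_; _∉_; ∣_∣; ⊥)
import Data.Fin.Subset.Properties as SubsetProperties
open import Data.Vec as Vec using (_∷_; lookup; tabulate)
open import Data.Vec.Properties using (lookup∘tabulate; lookup⇒[]=)
open import Data.List using ([]; _∷_; allFin; filter)
open import Data.List.Membership.Propositional using () renaming (_∈_ to _∈ₗ_)
open import Data.List.Membership.Propositional.Properties using (∈-filter⁺; ∈-filter⁻; ∈-allFin)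
open import Data.List.Relation.Unary.Any using (here; there)
open import Data.List.Relation.Unary.All as All using (All; []; _∷_)
open import Data.List.Relation.Unary.AllPairs using (AllPairs; []; _∷_)
import Data.List.Relation.Unary.AllPairs.Properties as AllPairsProperties
open import Data.List.Relation.Unary.Unique.Propositional using (Unique)
import Data.List.Relation.Unary.Unique.Propositional.Properties as UniqueProperties
open import Data.Product using (_,_; proj₁; proj₂; Σ-syntax)
open import Function.Bundles using (module Equivalence)
open import Data.Sum using (_⊎_; inj₁; inj₂)
open import Relation.Binary.Bundles using (Poset)
open import Relation.Binary.PropositionalEquality using (_≡_; refl; sym; trans; cong; subst)
open import Relation.Binary.Structures using (IsTotalOrder)
import Relation.Binary.Reasoning.PartialOrder as PosetReasoning
import Relation.Binary.Reasoning.Setoid as SetoidReasoning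
open import Relation.Nullary using (¬_; yes; no; ⌊_⌋)
open import Relation.Nullary.Decidable using (dec-true; isYes≗does)

module OrderedFieldProperties (F : OrderedField) where
  open OrderedField F public

  commutativeRing : CommutativeRing _ _
  commutativeRing = record { isCommutativeRing = isCommutativeRing }

  open CommutativeRing commutativeRing public
    using ( +-assoc; +-comm; +-identityˡ; +-identityʳ; -‿inverseˡ; -‿inverseʳ; -‿cong
          ; *-assoc; *-comm; *-identityˡ; distribˡ; distribʳ; zeroˡ; zeroʳ
          ; +-cong; +-congˡ; +-congʳ; *-congˡ; *-congʳ; semiring )
    renaming (refl to ≈-refl; reflexive to ≈-reflexive; sym to ≈-sym; trans to ≈-trans)
  open RingProperties (CommutativeRing.ring commutativeRing) public
    using (-‿distribˡ-*; -‿distribʳ-*; -‿involutive; -0#≈0#)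
  open IsTotalOrder isTotalOrder public
    using (total; antisym; ≤-respˡ-≈; ≤-respʳ-≈)
    renaming (refl to ≤-refl; reflexive to ≤-reflexive; trans to ≤-trans)
  open SemiringSum semiring public using (sum; sum-cong-≋; ∑-distrib-+; sum-replicate-zero)
  module +-Solver = CommutativeMonoidSolver (CommutativeRing.+-commutativeMonoid commutativeRing)

  poset : Poset _ _ _
  poset = record { isPartialOrder = IsTotalOrder.isPartialOrder isTotalOrder }

  module ≤-Reasoning = PosetReasoning poset
  module ≈-Reasoning = SetoidReasoning (CommutativeRing.setoid commutativeRing)

  x-y+y≈x : ∀ x y → (x - y) + y ≈ x
  x-y+y≈x x y = ≈-trans (+-assoc x (- y) y) (≈-trans (+-congˡ (-‿inverseˡ y)) (+-identityʳ x))

  x+y-y≈x : ∀ x y → (x + y) - y ≈ x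
  x+y-y≈x x y = ≈-trans (+-assoc x y (- y)) (≈-trans (+-congˡ (-‿inverseʳ y)) (+-identityʳ x))

  [x-1]*y≈x*y-y : ∀ x y → (x - 1#) * y ≈ x * y - y
  [x-1]*y≈x*y-y x y =
    ≈-trans (distribʳ y x (- 1#)) (+-congˡ (≈-trans (≈-sym (-‿distribˡ-* 1# y)) (-‿cong (*-identityˡ y))))

  +-monoʳ-≤ : ∀ {x y} z → x ≤ y → z + x ≤ z + y
  +-monoʳ-≤ {x} {y} z x≤y = ≤-respʳ-≈ (+-comm y z) (≤-respˡ-≈ (+-comm x z) (+-mono-≤ z x≤y))

  +-mono₂-≤ : ∀ {x y u v} → x ≤ y → u ≤ v → x + u ≤ y + v
  +-mono₂-≤ {y = y} {u} x≤y u≤v = ≤-trans (+-mono-≤ u x≤y) (+-monoʳ-≤ y u≤v)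

  +⇒≤- : ∀ {x y z} → x + z ≤ y → x ≤ y - z
  +⇒≤- {x} {y} {z} p = ≤-respˡ-≈ (x+y-y≈x x z) (+-mono-≤ (- z) p)

  ≤-⇒+ : ∀ {x y z} → x ≤ y - z → x + z ≤ y
  ≤-⇒+ {x} {y} {z} p = ≤-respʳ-≈ (x-y+y≈x y z) (+-mono-≤ z p)

  +-cancelʳ-≤ : ∀ {x y} z → x + z ≤ y + z → x ≤ y
  +-cancelʳ-≤ {x} {y} z p = ≤-respʳ-≈ (x+y-y≈x y z) (+⇒≤- p)

  0≤-⇒≤ : ∀ {x y} → 0# ≤ y - x → x ≤ y
  0≤-⇒≤ {x} p = ≤-respˡ-≈ (+-identityˡ x) (≤-⇒+ p)

  ≤⇒0≤- : ∀ {x y} → x ≤ y → 0# ≤ y - x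
  ≤⇒0≤- {x} p = +⇒≤- (≤-respˡ-≈ (≈-sym (+-identityˡ x)) p)

  ≤⇒-≤0 : ∀ {x y} → x ≤ y → x - y ≤ 0#
  ≤⇒-≤0 {x} {y} p = ≤-respʳ-≈ (-‿inverseʳ y) (+-mono-≤ (- y) p)

  -‿exchange-≤ : ∀ {x y u v} → x + v ≤ u + y → x - u ≤ y - v
  -‿exchange-≤ {x} {y} {u} {v} p =
    +⇒≤- (+-cancelʳ-≤ u (≤-respʳ-≈ (+-comm u y) (≤-respˡ-≈ (≈-sym rearranged) p)))
    where
    rearranged : ((x - u) + v) + u ≈ x + v
    rearranged = ≈-trans (+-assoc (x - u) v u) (≈-trans (+-congˡ (+-comm v u))
                 (≈-trans (≈-sym (+-assoc (x - u) u v)) (+-congʳ (x-y+y≈x x u))))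

  neg-antitone : ∀ {x y} → x ≤ y → - y ≤ - x
  neg-antitone {x} {y} p = 0≤-⇒≤ (≤-respʳ-≈ swapped (≤⇒0≤- p))
    where
    swapped : y - x ≈ - x - - y
    swapped = ≈-trans (+-comm y (- x)) (+-congˡ (≈-sym (-‿involutive y)))

  ≤⇒≥ : ∀ {x y} → ¬ (x ≤ y) → y ≤ x
  ≤⇒≥ {x} {y} x≰y with total x y
  ... | inj₁ x≤y = ⊥-elim (x≰y x≤y)
  ... | inj₂ y≤x = y≤x

  *-monoʳ-≤ : ∀ {x y} z → 0# ≤ z → x ≤ y → z * x ≤ z * y
  *-monoʳ-≤ {x} {y} z 0≤z p = 0≤-⇒≤ (≤-respʳ-≈ expand (*-nonneg 0≤z (≤⇒0≤- p)))
    where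
    expand : z * (y - x) ≈ z * y - z * x
    expand = ≈-trans (distribˡ z y (- x)) (+-congˡ (≈-sym (-‿distribʳ-* z x)))

  *-monoˡ-≤ : ∀ {x y} z → 0# ≤ z → x ≤ y → x * z ≤ y * z
  *-monoˡ-≤ {x} {y} z 0≤z p = ≤-respʳ-≈ (*-comm z y) (≤-respˡ-≈ (*-comm z x) (*-monoʳ-≤ z 0≤z p))

  +-nonneg : ∀ {x y} → 0# ≤ x → 0# ≤ y → 0# ≤ x + y
  +-nonneg p q = ≤-respˡ-≈ (+-identityʳ 0#) (+-mono₂-≤ p q)

  x≤x+y : ∀ {x y} → 0# ≤ y → x ≤ x + y
  x≤x+y {x} p = ≤-respˡ-≈ (+-identityʳ x) (+-monoʳ-≤ x p)

  0≰-1 : ¬ (0# ≤ - 1#)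
  0≰-1 0≤-1 = 0≉1 (antisym (≤-respʳ-≈ square (*-nonneg 0≤-1 0≤-1)) 1≤0)
    where
    square : - 1# * - 1# ≈ 1#
    square = ≈-trans (≈-sym (-‿distribˡ-* 1# (- 1#))) (≈-trans (-‿cong (*-identityˡ (- 1#))) (-‿involutive 1#))
    1≤0 : 1# ≤ 0#
    1≤0 = ≤-respʳ-≈ -0#≈0# (≤-respˡ-≈ (-‿involutive 1#) (neg-antitone 0≤-1))

  0≤1 : 0# ≤ 1#
  0≤1 = ≤⇒≥ (λ 1≤0 → 0≰-1 (≤-respˡ-≈ -0#≈0# (neg-antitone 1≤0)))

  ⁻¹-nonneg : ∀ {x} → 0# ≤ x → ¬ (x ≈ 0#) → 0# ≤ x ⁻¹
  ⁻¹-nonneg {x} 0≤x x≉0 = ≤⇒≥ (λ x⁻¹≤0 → 0≰-1 (≤-respʳ-≈ x*-x⁻¹≈-1 (*-nonneg 0≤x (≤-respˡ-≈ -0#≈0# (neg-antitone x⁻¹≤0)))))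
    where
    x*-x⁻¹≈-1 : x * - (x ⁻¹) ≈ - 1#
    x*-x⁻¹≈-1 = ≈-trans (≈-sym (-‿distribʳ-* x (x ⁻¹))) (-‿cong (⁻¹-inverse x x≉0))

  x≤k*x : ∀ {k x} → 1# ≤ k → 0# ≤ x → x ≤ k * x
  x≤k*x {k} {x} 1≤k 0≤x = 0≤-⇒≤ (≤-respʳ-≈ ([x-1]*y≈x*y-y k x) (*-nonneg (≤⇒0≤- 1≤k) 0≤x))

  fromℕ-nonneg : ∀ k → 0# ≤ fromℕ k
  fromℕ-nonneg zero = ≤-refl
  fromℕ-nonneg (suc k) = +-nonneg 0≤1 (fromℕ-nonneg k)

  fromℕ-mono : ∀ {i j} → i ℕ.≤ j → fromℕ i ≤ fromℕ j
  fromℕ-mono {zero} {j} ℕ.z≤n = fromℕ-nonneg j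
  fromℕ-mono (ℕ.s≤s i≤j) = +-monoʳ-≤ 1# (fromℕ-mono i≤j)

  fromℕ-suc≉0 : ∀ k → ¬ (fromℕ (suc k) ≈ 0#)
  fromℕ-suc≉0 k eq = 0≉1 (antisym 0≤1 (≤-respʳ-≈ eq (x≤x+y (fromℕ-nonneg k))))

  fromℕ-+ : ∀ i j → fromℕ (i ℕ.+ j) ≈ fromℕ i + fromℕ j
  fromℕ-+ zero j = ≈-sym (+-identityˡ _)
  fromℕ-+ (suc i) j = ≈-trans (+-congˡ (fromℕ-+ i j)) (≈-sym (+-assoc _ _ _))

  sum-mono : ∀ {k} {g h : Fin k → Carrier} → (∀ i → g i ≤ h i) → sum g ≤ sum h
  sum-mono {zero} p = ≤-refl
  sum-mono {suc k} p = +-mono₂-≤ (p Fin.zero) (sum-mono (λ i → p (Fin.suc i)))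

  sum-nonneg : ∀ {k} {g : Fin k → Carrier} → (∀ i → 0# ≤ g i) → 0# ≤ sum g
  sum-nonneg {zero} p = ≤-refl
  sum-nonneg {suc k} p = +-nonneg (p Fin.zero) (sum-nonneg (λ i → p (Fin.suc i)))

  [_]·_ : Bool → Carrier → Carrier
  [ t ]· x = if t then x else 0#

  []·-nonneg : ∀ t {x} → 0# ≤ x → 0# ≤ [ t ]· x
  []·-nonneg true 0≤x = 0≤x
  []·-nonneg false _ = ≤-refl

  [∨]· : ∀ a c x → (a ∧ c) ≡ false → [ a ∨ c ]· x ≈ [ a ]· x + [ c ]· x
  [∨]· true false x refl = ≈-sym (+-identityʳ x)
  [∨]· false c x refl = ≈-sym (+-identityˡ _)

  term≤sum : ∀ {k} {g : Fin k → Carrier} → (∀ i → 0# ≤ g i) → ∀ u → g u ≤ sum g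
  term≤sum {suc k} 0≤g Fin.zero = x≤x+y (sum-nonneg (λ i → 0≤g (Fin.suc i)))
  term≤sum {suc k} {g} 0≤g (Fin.suc u) =
    ≤-trans (term≤sum (λ i → 0≤g (Fin.suc i)) u)
            (≤-respʳ-≈ (+-comm _ (g Fin.zero)) (x≤x+y (0≤g Fin.zero)))

  sum-supported : ∀ {k} (h : Fin k → Carrier) u → (∀ v → ¬ v ≡ u → h v ≈ 0#) → sum h ≈ h u
  sum-supported {suc k} h Fin.zero vanish =
    ≈-trans (+-congˡ (≈-trans (sum-cong-≋ (λ v → vanish (Fin.suc v) λ ())) (sum-replicate-zero k)))
            (+-identityʳ (h Fin.zero))
  sum-supported {suc k} h (Fin.suc u) vanish =
    ≈-trans (+-congʳ (vanish Fin.zero λ ()))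
   (≈-trans (+-identityˡ _)
            (sum-supported (λ v → h (Fin.suc v)) u (λ v v≢u → vanish (Fin.suc v) (λ eq → v≢u (FinProperties.suc-injective eq)))))

  sum-single : ∀ {k} (g : Fin k → Carrier) u → sum (λ v → [ ⌊ v Fin.≟ u ⌋ ]· g v) ≈ g u
  sum-single g u = ≈-trans (sum-supported _ u vanish) at-u
    where
    vanish : ∀ v → ¬ v ≡ u → [ ⌊ v Fin.≟ u ⌋ ]· g v ≈ 0#
    vanish v v≢u with v Fin.≟ u
    ... | yes v≡u = ⊥-elim (v≢u v≡u)
    ... | no _ = ≈-refl
    at-u : [ ⌊ u Fin.≟ u ⌋ ]· g u ≈ g u
    at-u with u Fin.≟ u
    ... | yes _ = ≈-refl
    ... | no u≢u = ⊥-elim (u≢u refl)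

module SubsetLemmas where
  bit : Bool → ℕ
  bit true = 1
  bit false = 0

  ∣∷∣ : ∀ {k} t (r : Subset k) → ∣ t ∷ r ∣ ≡ bit t ℕ.+ ∣ r ∣
  ∣∷∣ true r = refl
  ∣∷∣ false r = refl

  ∩-monoˡ : ∀ {k} {A A′ B : Subset k} → A ⊆ A′ → A ∩ B ⊆ A′ ∩ B
  ∩-monoˡ {A = A} {B = B} A⊆A′ x∈ = let (x∈A , x∈B) = SubsetProperties.x∈p∩q⁻ A B x∈
                                    in SubsetProperties.x∈p∩q⁺ (A⊆A′ x∈A , x∈B)

  ∩-monoʳ : ∀ {k} {A B B′ : Subset k} → B ⊆ B′ → A ∩ B ⊆ A ∩ B′
  ∩-monoʳ {A = A} {B} B⊆B′ x∈ = let (x∈A , x∈B) = SubsetProperties.x∈p∩q⁻ A B x∈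
                                in SubsetProperties.x∈p∩q⁺ (x∈A , B⊆B′ x∈B)

  ∣⊥∩q∣≡0 : ∀ {k} (q : Subset k) → ∣ ⊥ ∩ q ∣ ≡ 0
  ∣⊥∩q∣≡0 {k} q = trans (cong ∣_∣ (SubsetProperties.∩-zeroˡ q)) (SubsetProperties.∣⊥∣≡0 k)

  ∣p∪⁅e⁆∩q∣≡ : ∀ {k} (p q : Subset k) e → e ∉ p →
               ∣ (p ∪ ⁅ e ⁆) ∩ q ∣ ≡ ∣ p ∩ q ∣ ℕ.+ bit (lookup q e)
  ∣p∪⁅e⁆∩q∣≡ (true ∷ p) (t ∷ q) Fin.zero e∉p = ⊥-elim (e∉p Vec.here)
  ∣p∪⁅e⁆∩q∣≡ (false ∷ p) (t ∷ q) Fin.zero _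
    rewrite SubsetProperties.∪-identityʳ p | ∣∷∣ t (p ∩ q) = ℕProperties.+-comm (bit t) ∣ p ∩ q ∣
  ∣p∪⁅e⁆∩q∣≡ (s ∷ p) (t ∷ q) (Fin.suc e) e∉p
    rewrite BoolProperties.∨-identityʳ s | ∣∷∣ (s ∧ t) ((p ∪ ⁅ e ⁆) ∩ q) | ∣∷∣ (s ∧ t) (p ∩ q)
          | ∣p∪⁅e⁆∩q∣≡ p q e (λ e∈p → e∉p (Vec.there e∈p))
    = sym (ℕProperties.+-assoc (bit (s ∧ t)) ∣ p ∩ q ∣ (bit (lookup q e)))

  ∣p∪⁅e⁆∩q∣≤ : ∀ {k} (p q : Subset k) e → ∣ (p ∪ ⁅ e ⁆) ∩ q ∣ ℕ.≤ ∣ p ∩ q ∣ ℕ.+ bit (lookup q e)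
  ∣p∪⁅e⁆∩q∣≤ (s ∷ p) (t ∷ q) Fin.zero
    rewrite SubsetProperties.∪-identityʳ p | BoolProperties.∨-zeroʳ s | ∣∷∣ t (p ∩ q) | ∣∷∣ (s ∧ t) (p ∩ q)
    = ℕProperties.≤-trans (ℕProperties.≤-reflexive (ℕProperties.+-comm (bit t) ∣ p ∩ q ∣))
                          (ℕProperties.+-monoˡ-≤ (bit t) (ℕProperties.m≤n+m ∣ p ∩ q ∣ (bit (s ∧ t))))
  ∣p∪⁅e⁆∩q∣≤ (s ∷ p) (t ∷ q) (Fin.suc e)
    rewrite BoolProperties.∨-identityʳ s | ∣∷∣ (s ∧ t) ((p ∪ ⁅ e ⁆) ∩ q) | ∣∷∣ (s ∧ t) (p ∩ q)
    = ℕProperties.≤-trans (ℕProperties.+-monoʳ-≤ (bit (s ∧ t)) (∣p∪⁅e⁆∩q∣≤ p q e))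
                          (ℕProperties.≤-reflexive (sym (ℕProperties.+-assoc (bit (s ∧ t)) ∣ p ∩ q ∣ (bit (lookup q e)))))

module GraphProperties {n m : ℕ} (ends : Fin m → Fin n × Fin n) where
  open Graph ends
  open SubsetLemmas

  incident⇒endpoint : ∀ e v → incident e v ≡ true → v ≡ proj₁ (ends e) ⊎ v ≡ proj₂ (ends e)
  incident⇒endpoint e v eq with v Fin.≟ proj₁ (ends e) | v Fin.≟ proj₂ (ends e)
  ... | yes v≡u | _ = inj₁ v≡u
  ... | no _ | yes v≡w = inj₂ v≡w
  incident⇒endpoint e v () | no _ | no _

  incident-proj₁ : ∀ e → incident e (proj₁ (ends e)) ≡ true
  incident-proj₁ e with proj₁ (ends e) Fin.≟ proj₁ (ends e)
  ... | yes _ = refl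
  ... | no u≢u = ⊥-elim (u≢u refl)

  incident-proj₂ : ∀ e → incident e (proj₂ (ends e)) ≡ true
  incident-proj₂ e with proj₂ (ends e) Fin.≟ proj₂ (ends e)
  ... | yes _ = BoolProperties.∨-zeroʳ _
  ... | no w≢w = ⊥-elim (w≢w refl)

  deg-⊥ : ∀ v → deg ⊥ v ≡ 0
  deg-⊥ v = ∣⊥∩q∣≡0 (tabulate (λ e → incident e v))

  deg-insert≡ : ∀ M e v → e ∉ M → deg (M ∪ ⁅ e ⁆) v ≡ deg M v ℕ.+ bit (incident e v)
  deg-insert≡ M e v e∉M =
    trans (∣p∪⁅e⁆∩q∣≡ M _ e e∉M) (cong (λ t → deg M v ℕ.+ bit t) (lookup∘tabulate (λ e → incident e v) e))

  deg-insert≤ : ∀ M e v → deg (M ∪ ⁅ e ⁆) v ℕ.≤ deg M v ℕ.+ bit (incident e v)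
  deg-insert≤ M e v =
    subst (λ t → deg (M ∪ ⁅ e ⁆) v ℕ.≤ deg M v ℕ.+ bit t) (lookup∘tabulate (λ e → incident e v) e) (∣p∪⁅e⁆∩q∣≤ M _ e)

  deg-mono : ∀ {M M'} → M ⊆ M' → ∀ v → deg M v ℕ.≤ deg M' v
  deg-mono M⊆M' v = SubsetProperties.p⊆q⇒∣p∣≤∣q∣ (∩-monoˡ M⊆M')

  ∈-toSet⁺ : ∀ {e} L → e ∈ₗ L → e ∈ toSet L
  ∈-toSet⁺ (e ∷ L) (here refl) = SubsetProperties.x∈p∪q⁺ (inj₁ (SubsetProperties.x∈⁅x⁆ e))
  ∈-toSet⁺ (x ∷ L) (there e∈L) = SubsetProperties.x∈p∪q⁺ (inj₂ (∈-toSet⁺ L e∈L))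

  ∈-toSet⁻ : ∀ {e} L → e ∈ toSet L → e ∈ₗ L
  ∈-toSet⁻ [] e∈⊥ = ⊥-elim (SubsetProperties.∉⊥ e∈⊥)
  ∈-toSet⁻ (x ∷ L) e∈ with SubsetProperties.x∈p∪q⁻ ⁅ x ⁆ (toSet L) e∈
  ... | inj₁ e∈⁅x⁆ = here (SubsetProperties.x∈⁅y⁆⇒x≡y x e∈⁅x⁆)
  ... | inj₂ e∈L = there (∈-toSet⁻ L e∈L)

  module PostProcessing (b : Fin n → ℕ) where
    admits : Subset m → Fin m → Bool
    admits M e = (deg M (proj₁ (ends e)) <ᵇ b (proj₁ (ends e))) ∧ (deg M (proj₂ (ends e)) <ᵇ b (proj₂ (ends e)))

    admitted⇒unsaturated : ∀ M e → T (admits M e) → ∀ v → incident e v ≡ true → deg M v ℕ.< b v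
    admitted⇒unsaturated M e ok v inc with Equivalence.to (BoolProperties.T-∧ {deg M (proj₁ (ends e)) <ᵇ b (proj₁ (ends e))}) ok | incident⇒endpoint e v inc
    ... | u-ok , _ | inj₁ refl = ℕProperties.<ᵇ⇒< (deg M v) (b v) u-ok
    ... | _ , w-ok | inj₂ refl = ℕProperties.<ᵇ⇒< (deg M v) (b v) w-ok

    rejected⇒saturated : ∀ M e → ¬ T (admits M e) →
                         Σ[ v ∈ Fin n ] incident e v ≡ true × b v ℕ.≤ deg M v
    rejected⇒saturated M e ¬ok with BoolProperties.T? (deg M (proj₁ (ends e)) <ᵇ b (proj₁ (ends e)))
    ... | no ¬u-ok = proj₁ (ends e) , incident-proj₁ e , ℕProperties.≮⇒≥ (λ lt → ¬u-ok (ℕProperties.<⇒<ᵇ lt))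
    ... | yes u-ok = proj₂ (ends e) , incident-proj₂ e ,
                     ℕProperties.≮⇒≥ (λ lt → ¬ok (Equivalence.from BoolProperties.T-∧ (u-ok , ℕProperties.<⇒<ᵇ lt)))

    insertIfAdmitted : Subset m → Fin m → Subset m
    insertIfAdmitted M e = if admits M e then M ∪ ⁅ e ⁆ else M

    insertIfAdmitted-bmatching : ∀ M e → IsBMatching b M → IsBMatching b (insertIfAdmitted M e)
    insertIfAdmitted-bmatching M e bm with admits M e in ok
    ... | false = bm
    ... | true = λ v → ℕProperties.≤-trans (deg-insert≤ M e v) (fits v (incident e v) refl)
      where
      fits : ∀ v t → incident e v ≡ t → deg M v ℕ.+ bit t ℕ.≤ b v
      fits v false _ = ℕProperties.≤-trans (ℕProperties.≤-reflexive (ℕProperties.+-identityʳ _)) (bm v)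
      fits v true inc = ℕProperties.≤-trans (ℕProperties.≤-reflexive (ℕProperties.+-comm (deg M v) 1))
                                            (admitted⇒unsaturated M e (subst T (sym ok) _) v inc)

    postProcess-bmatching : ∀ L M → IsBMatching b M → IsBMatching b (postProcess b L M)
    postProcess-bmatching [] M bm = bm
    postProcess-bmatching (e ∷ L) M bm = postProcess-bmatching L _ (insertIfAdmitted-bmatching M e bm)

    output-bmatching : ∀ S → IsBMatching b (postProcess b S ⊥)
    output-bmatching S = postProcess-bmatching S ⊥ (λ v → subst (ℕ._≤ b v) (sym (deg-⊥ v)) ℕ.z≤n)

    ⊆-insertIfAdmitted : ∀ M e → M ⊆ insertIfAdmitted M e
    ⊆-insertIfAdmitted M e with admits M e
    ... | true = SubsetProperties.p⊆p∪q ⁅ e ⁆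
    ... | false = λ x∈M → x∈M

    ⊆-postProcess : ∀ L M → M ⊆ postProcess b L M
    ⊆-postProcess [] M x∈M = x∈M
    ⊆-postProcess (e ∷ L) M x∈M = ⊆-postProcess L _ (⊆-insertIfAdmitted M e x∈M)

module SubmodularProperties (F : OrderedField) {m : ℕ} (f : Subset m → OrderedField.Carrier F)
                            (mono : SetFunctions.Monotone F f) (submod : SetFunctions.Submodular F f) where
  open OrderedFieldProperties F
  open SetFunctions F f

  f-insert : ∀ A e → f (A ∪ ⁅ e ⁆) ≈ f A + marginal A e
  f-insert A e = ≈-trans (≈-sym (x-y+y≈x (f (A ∪ ⁅ e ⁆)) (f A))) (+-comm _ _)

  marginal-nonneg : ∀ A e → 0# ≤ marginal A e
  marginal-nonneg A e = ≤⇒0≤- (mono _ _ (SubsetProperties.p⊆p∪q ⁅ e ⁆))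

  marginal-of-member : ∀ A e → e ∈ A → marginal A e ≤ 0#
  marginal-of-member A e e∈A = ≤⇒-≤0 (mono _ _ A∪⁅e⁆⊆A)
    where
    A∪⁅e⁆⊆A : A ∪ ⁅ e ⁆ ⊆ A
    A∪⁅e⁆⊆A x∈ with SubsetProperties.x∈p∪q⁻ A ⁅ e ⁆ x∈
    ... | inj₁ x∈A = x∈A
    ... | inj₂ x∈⁅e⁆ rewrite SubsetProperties.x∈⁅y⁆⇒x≡y e x∈⁅e⁆ = e∈A

  -- f(Y ∪ e) + f(X) ≤ f(Y ∪ (X ∪ e)) + f(Y ∩ (X ∪ e)) ≤ f(Y) + f(X ∪ e).
  marginal-antitone : ∀ {X Y} e → X ⊆ Y → marginal Y e ≤ marginal X e
  marginal-antitone {X} {Y} e X⊆Y =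
    -‿exchange-≤ (≤-trans (+-mono₂-≤ (mono _ _ Y∪⁅e⁆⊆) (mono _ _ X⊆)) (submod Y (X ∪ ⁅ e ⁆)))
    where
    Y∪⁅e⁆⊆ : Y ∪ ⁅ e ⁆ ⊆ Y ∪ (X ∪ ⁅ e ⁆)
    Y∪⁅e⁆⊆ x∈ with SubsetProperties.x∈p∪q⁻ Y ⁅ e ⁆ x∈
    ... | inj₁ x∈Y = SubsetProperties.p⊆p∪q (X ∪ ⁅ e ⁆) x∈Y
    ... | inj₂ x∈⁅e⁆ = SubsetProperties.q⊆p∪q Y (X ∪ ⁅ e ⁆) (SubsetProperties.q⊆p∪q X ⁅ e ⁆ x∈⁅e⁆)
    X⊆ : X ⊆ Y ∩ (X ∪ ⁅ e ⁆)
    X⊆ x∈X = SubsetProperties.x∈p∩q⁺ (X⊆Y x∈X , SubsetProperties.p⊆p∪q ⁅ e ⁆ x∈X)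

-- A stack is represented top
-- first; since every edge is pushed on top of earlier edges, the
-- potentials and the gains of a stack are functions of the stack alone.
module MSbMAnalysis (F : OrderedField) {n m : ℕ} (ends : Fin m → Fin n × Fin n)
                    (loopless : ∀ e → ¬ (proj₁ (ends e) ≡ proj₂ (ends e)))
                    (b : Fin n → ℕ) (b-pos : ∀ v → 0 < b v)
                    (f : Subset m → OrderedField.Carrier F)
                    (mono : SetFunctions.Monotone F f) (submod : SetFunctions.Submodular F f)
                    (C : OrderedField.Carrier F) (1<C : OrderedField._<ᶠ_ F (OrderedField.1# F) C) where
  open OrderedFieldProperties F
  open SubsetLemmas using (bit; ∩-monoʳ)
  open Graph ends
  open GraphProperties ends
  open PostProcessing b
  open SetFunctions F f
  open SubmodularProperties F f mono submod
  open MSbM F ends b f C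

  1≤C : 1# ≤ C
  1≤C = proj₁ 1<C

  0≤C : 0# ≤ C
  0≤C = ≤-trans 0≤1 1≤C

  C-1≉0 : ¬ (C - 1# ≈ 0#)
  C-1≉0 C-1≈0 = proj₂ 1<C (≈-sym (≈-trans (≈-sym (x-y+y≈x C 1#)) (≈-trans (+-congʳ C-1≈0) (+-identityˡ 1#))))

  0≤[C-1]⁻¹ : 0# ≤ (C - 1#) ⁻¹
  0≤[C-1]⁻¹ = ⁻¹-nonneg (≤⇒0≤- 1≤C) C-1≉0

  bᶠ : Fin n → Carrier
  bᶠ v = fromℕ (b v)

  bᶠ≉0 : ∀ v → ¬ (bᶠ v ≈ 0#)
  bᶠ≉0 v with b v | b-pos v
  ... | suc k | _ = fromℕ-suc≉0 k

  0≤bᶠ⁻¹ : ∀ v → 0# ≤ bᶠ v ⁻¹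
  0≤bᶠ⁻¹ v = ⁻¹-nonneg (fromℕ-nonneg (b v)) (bᶠ≉0 v)

  bᶠ*[]· : ∀ v t x → bᶠ v * [ t ]· (x * bᶠ v ⁻¹) ≈ [ t ]· x
  bᶠ*[]· v true x = ≈-trans (*-congˡ (*-comm x _)) (≈-trans (≈-sym (*-assoc _ _ _))
                     (≈-trans (*-congʳ (⁻¹-inverse (bᶠ v) (bᶠ≉0 v))) (*-identityˡ x)))
  bᶠ*[]· v false x = zeroʳ (bᶠ v)

  Φ : List (Fin m) → Potentials
  Φ [] = λ _ → 0#
  Φ (e ∷ L) = update (Φ L) e L

  excess : Fin m → List (Fin m) → Carrier
  excess e L = gain e L - φsum (Φ L) e

  totalExcess : List (Fin m) → Carrier
  totalExcess [] = 0#
  totalExcess (e ∷ L) = excess e L + totalExcess L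

  Φ-push : ∀ e L v → Φ (e ∷ L) v ≈ Φ L v + [ incident e v ]· (excess e L * bᶠ v ⁻¹)
  Φ-push e L v with incident e v
  ... | true = ≈-refl
  ... | false = ≈-sym (+-identityʳ (Φ L v))

  data Valid : List (Fin m) → Set where
    empty  : Valid []
    pushed : ∀ {e L} → All (Fin._< e) L → ¬ (gain e L ≤ C * φsum (Φ L) e) → Valid L → Valid (e ∷ L)

  -- Potentials and excesses of a valid stack are non-negative: by
  -- induction, the endpoint potentials s of a pushed edge satisfy
  -- 0 ≤ s ≤ C * s < gain, so its excess and the raise it causes are ≥ 0.
  mutual
    Φ-nonneg : ∀ {L} → Valid L → ∀ v → 0# ≤ Φ L v
    Φ-nonneg empty v = ≤-refl
    Φ-nonneg {e ∷ L} V@(pushed _ _ V') v =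
      ≤-respʳ-≈ (≈-sym (Φ-push e L v)) (+-nonneg (Φ-nonneg V' v) (increment-nonneg V v))

    excess-nonneg : ∀ {e L} → Valid (e ∷ L) → 0# ≤ excess e L
    excess-nonneg {e} (pushed _ fails V) =
      ≤⇒0≤- (≤-trans (x≤k*x 1≤C (φsum-nonneg V e)) (≤⇒≥ fails))

    increment-nonneg : ∀ {e L} → Valid (e ∷ L) → ∀ v → 0# ≤ [ incident e v ]· (excess e L * bᶠ v ⁻¹)
    increment-nonneg {e} V v with incident e v
    ... | true = *-nonneg (excess-nonneg V) (0≤bᶠ⁻¹ v)
    ... | false = ≤-refl

    φsum-nonneg : ∀ {L} → Valid L → ∀ e → 0# ≤ φsum (Φ L) e
    φsum-nonneg V e = +-nonneg (Φ-nonneg V _) (Φ-nonneg V _)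

  Φ-grows : ∀ {e L} → Valid (e ∷ L) → ∀ v → Φ L v ≤ Φ (e ∷ L) v
  Φ-grows {e} {L} V v = ≤-respʳ-≈ (≈-sym (Φ-push e L v)) (x≤x+y (increment-nonneg V v))

  record Outcome (es S S' : List (Fin m)) : Set where
    field
      valid   : Valid S'
      grows   : ∀ v → Φ S v ≤ Φ S' v
      extends : toSet S ⊆ toSet S'
      covered : ∀ e → e ∈ₗ es → marginal (toSet S') e ≤ C * φsum (Φ S') e

  marginal≤gain : ∀ S S' e → toSet S ⊆ toSet S' → marginal (toSet S') e ≤ gain e S
  marginal≤gain S S' e S⊆S' = marginal-antitone e (λ x∈ → S⊆S' (SubsetProperties.p∩q⊆p (toSet S) (before e) x∈))

  -- By induction along the stream (which is sorted and lies above S): a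
  -- skipped edge is covered because its gain was below the threshold, a
  -- pushed edge because it belongs to the final stack.
  process-outcome : ∀ {es S S' φ'} → Process es S (Φ S) S' φ' →
                    Valid S → AllPairs Fin._<_ es → All (λ x → All (x Fin.<_) es) S → Outcome es S S'
  process-outcome done V _ _ = record { valid = V ; grows = λ v → ≤-refl ; extends = λ x∈ → x∈ ; covered = λ _ () }
  process-outcome {e ∷ es} {S} {S'} (skip below-threshold P) V (_ ∷ sorted) below =
    record { valid = valid ; grows = grows ; extends = extends ; covered = covered′ }
    where
    open Outcome (process-outcome P V sorted (All.map All.tail below))
    covered′ : ∀ x → x ∈ₗ e ∷ es → marginal (toSet S') x ≤ C * φsum (Φ S') x
    covered′ x (there x∈es) = covered x x∈es
    covered′ x (here refl) =
      ≤-trans (marginal≤gain S S' x extends) (≤-trans below-threshold (*-monoʳ-≤ C 0≤C (+-mono₂-≤ (grows _) (grows _))))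
  process-outcome {e ∷ es} {S} {S'} (push above-threshold P) V (e<es ∷ sorted) below =
    record { valid = valid ; grows = λ v → ≤-trans (Φ-grows V′ v) (grows v)
           ; extends = λ x∈ → extends (SubsetProperties.q⊆p∪q ⁅ e ⁆ (toSet S) x∈) ; covered = covered′ }
    where
    V′ : Valid (e ∷ S)
    V′ = pushed (All.map All.head below) above-threshold V
    open Outcome (process-outcome P V′ sorted (e<es ∷ All.map All.tail below))
    covered′ : ∀ x → x ∈ₗ e ∷ es → marginal (toSet S') x ≤ C * φsum (Φ S') x
    covered′ x (there x∈es) = covered x x∈es
    covered′ x (here refl) =
      ≤-trans (marginal-of-member (toSet S') x (extends (∈-toSet⁺ (x ∷ S) (here refl))))
              (*-nonneg 0≤C (φsum-nonneg valid x))

  run-outcome : ∀ {S φ} → Run S φ → Outcome (allFin m) [] S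
  run-outcome run = process-outcome run empty stream-sorted []
    where
    stream-sorted : AllPairs Fin._<_ (allFin m)
    stream-sorted = AllPairsProperties.tabulate⁺-< (λ i<j → i<j)

  -- the constant C/(C-1) bounding the gain of a pushed edge by its excess
  ratio : Carrier
  ratio = C * (C - 1#) ⁻¹

  0≤ratio : 0# ≤ ratio
  0≤ratio = *-nonneg 0≤C 0≤[C-1]⁻¹

  ratio≈1+[C-1]⁻¹ : ratio ≈ 1# + (C - 1#) ⁻¹
  ratio≈1+[C-1]⁻¹ = ≈-trans (*-congʳ (≈-sym (x-y+y≈x C 1#)))
                    (≈-trans (distribʳ ((C - 1#) ⁻¹) (C - 1#) 1#) (+-cong (⁻¹-inverse (C - 1#) C-1≉0) (*-identityˡ _)))

  -- If C * s ≤ g and s ≥ 0 then g ≤ C/(C-1) * (g - s), because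
  -- (C - 1) * s ≤ g - s.
  gain≤ratio*excess : ∀ {g s} → 0# ≤ s → C * s ≤ g → g ≤ ratio * (g - s)
  gain≤ratio*excess {g} {s} 0≤s Cs≤g = begin
    g                                   ≈⟨ ≈-sym (x-y+y≈x g s) ⟩
    (g - s) + s                         ≤⟨ +-monoʳ-≤ (g - s) s≤[g-s]/[C-1] ⟩
    (g - s) + (C - 1#) ⁻¹ * (g - s)     ≈⟨ +-congʳ (≈-sym (*-identityˡ (g - s))) ⟩
    1# * (g - s) + (C - 1#) ⁻¹ * (g - s) ≈⟨ ≈-sym (distribʳ (g - s) 1# ((C - 1#) ⁻¹)) ⟩
    (1# + (C - 1#) ⁻¹) * (g - s)        ≈⟨ *-congʳ (≈-sym ratio≈1+[C-1]⁻¹) ⟩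
    ratio * (g - s)                     ∎
    where
    open ≤-Reasoning
    s≤[g-s]/[C-1] : s ≤ (C - 1#) ⁻¹ * (g - s)
    s≤[g-s]/[C-1] = begin
      s                                 ≈⟨ ≈-sym (*-identityˡ s) ⟩
      1# * s                            ≈⟨ *-congʳ (≈-sym (≈-trans (*-comm _ _) (⁻¹-inverse (C - 1#) C-1≉0))) ⟩
      ((C - 1#) ⁻¹ * (C - 1#)) * s      ≈⟨ *-assoc _ _ _ ⟩
      (C - 1#) ⁻¹ * ((C - 1#) * s)      ≤⟨ *-monoʳ-≤ _ 0≤[C-1]⁻¹ (≤-respˡ-≈ (≈-sym ([x-1]*y≈x*y-y C s)) (+-mono-≤ (- s) Cs≤g)) ⟩
      (C - 1#) ⁻¹ * (g - s)             ∎

  stack-value : ∀ {L} → Valid L → f (toSet L) ≤ f ⊥ + ratio * totalExcess L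
  stack-value empty = ≤-respʳ-≈ (≈-trans (≈-sym (+-identityʳ (f ⊥))) (+-congˡ (≈-sym (zeroʳ ratio)))) ≤-refl
  stack-value {e ∷ L} (pushed _ fails V) = begin
    f (⁅ e ⁆ ∪ toSet L)                          ≡⟨ cong f (SubsetProperties.∪-comm ⁅ e ⁆ (toSet L)) ⟩
    f (toSet L ∪ ⁅ e ⁆)                          ≈⟨ f-insert (toSet L) e ⟩
    f (toSet L) + marginal (toSet L) e           ≤⟨ +-mono₂-≤ (stack-value V) (marginal≤gain L L e (λ x∈ → x∈)) ⟩
    (f ⊥ + ratio * totalExcess L) + gain e L     ≤⟨ +-monoʳ-≤ _ (gain≤ratio*excess (φsum-nonneg V e) (≤⇒≥ fails)) ⟩
    (f ⊥ + ratio * totalExcess L) + ratio * excess e L ≈⟨ +-assoc _ _ _ ⟩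
    f ⊥ + (ratio * totalExcess L + ratio * excess e L) ≈⟨ +-congˡ (≈-sym (distribˡ ratio _ _)) ⟩
    f ⊥ + ratio * (totalExcess L + excess e L)   ≈⟨ +-congˡ (*-congˡ (+-comm _ _)) ⟩
    f ⊥ + ratio * totalExcess (e ∷ L)            ∎
    where open ≤-Reasoning

  -- Σ_v [v ∈ e] X_v = X_u + X_w, because the endpoints u ≠ w of e are distinct.
  sum-incident : ∀ e (X : Fin n → Carrier) → sum (λ v → [ incident e v ]· X v) ≈ φsum X e
  sum-incident e X = begin
    sum (λ v → [ incident e v ]· X v)                           ≈⟨ sum-cong-≋ (λ v → [∨]· _ _ (X v) (exclusive v)) ⟩
    sum (λ v → [ ⌊ v Fin.≟ u ⌋ ]· X v + [ ⌊ v Fin.≟ w ⌋ ]· X v) ≈⟨ ∑-distrib-+ (λ v → [ ⌊ v Fin.≟ u ⌋ ]· X v) (λ v → [ ⌊ v Fin.≟ w ⌋ ]· X v) ⟩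
    sum (λ v → [ ⌊ v Fin.≟ u ⌋ ]· X v) + sum (λ v → [ ⌊ v Fin.≟ w ⌋ ]· X v)
                                                                ≈⟨ +-cong (sum-single X u) (sum-single X w) ⟩
    X u + X w                                                   ∎
    where
    open ≈-Reasoning
    u = proj₁ (ends e)
    w = proj₂ (ends e)
    exclusive : ∀ v → (⌊ v Fin.≟ u ⌋ ∧ ⌊ v Fin.≟ w ⌋) ≡ false
    exclusive v with v Fin.≟ u | v Fin.≟ w
    ... | yes refl | yes v≡w = ⊥-elim (loopless e v≡w)
    ... | yes _ | no _ = refl
    ... | no _ | _ = refl

  -- Each push raises Σ_v b_v φ_v by twice the excess of the pushed edge.
  potential-mass : ∀ L → sum (λ v → bᶠ v * Φ L v) ≈ totalExcess L + totalExcess L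
  potential-mass [] =
    ≈-trans (sum-cong-≋ (λ v → zeroʳ (bᶠ v))) (≈-trans (sum-replicate-zero n) (≈-sym (+-identityʳ 0#)))
  potential-mass (e ∷ L) = begin
    sum (λ v → bᶠ v * Φ (e ∷ L) v)                        ≈⟨ sum-cong-≋ b*push ⟩
    sum (λ v → bᶠ v * Φ L v + [ incident e v ]· excess e L) ≈⟨ ∑-distrib-+ (λ v → bᶠ v * Φ L v) (λ v → [ incident e v ]· excess e L) ⟩
    sum (λ v → bᶠ v * Φ L v) + sum (λ v → [ incident e v ]· excess e L)
                                                           ≈⟨ +-cong (potential-mass L) (sum-incident e (λ _ → excess e L)) ⟩
    (totalExcess L + totalExcess L) + (excess e L + excess e L)
                                                           ≈⟨ +-Solver.solve 2 (λ d x → (d ⊕ d) ⊕ (x ⊕ x) ⊜ (x ⊕ d) ⊕ (x ⊕ d)) ≈-refl _ _ ⟩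
    totalExcess (e ∷ L) + totalExcess (e ∷ L)              ∎
    where
    open ≈-Reasoning
    open +-Solver using (_⊕_; _⊜_)
    b*push : ∀ v → bᶠ v * Φ (e ∷ L) v ≈ bᶠ v * Φ L v + [ incident e v ]· excess e L
    b*push v = ≈-trans (*-congˡ (Φ-push e L v)) (≈-trans (distribˡ _ _ _) (+-congˡ (bᶠ*[]· v (incident e v) _)))

  -- Σ_v deg_M(v) X_v: the potentials X summed over the endpoints of the
  -- edges of M, with multiplicity.
  potentialOf : Subset m → Potentials → Carrier
  potentialOf M X = sum (λ v → fromℕ (deg M v) * X v)

  potentialOf-⊥ : ∀ X → potentialOf ⊥ X ≈ 0#
  potentialOf-⊥ X =
    ≈-trans (sum-cong-≋ (λ v → ≈-trans (*-congʳ (≈-reflexive (cong fromℕ (deg-⊥ v)))) (zeroˡ (X v))))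
            (sum-replicate-zero n)

  potentialOf-insert : ∀ M e X → e ∉ M → potentialOf (M ∪ ⁅ e ⁆) X ≈ potentialOf M X + φsum X e
  potentialOf-insert M e X e∉M = begin
    potentialOf (M ∪ ⁅ e ⁆) X                                      ≈⟨ sum-cong-≋ pointwise ⟩
    sum (λ v → fromℕ (deg M v) * X v + [ incident e v ]· X v)      ≈⟨ ∑-distrib-+ (λ v → fromℕ (deg M v) * X v) (λ v → [ incident e v ]· X v) ⟩
    potentialOf M X + sum (λ v → [ incident e v ]· X v)            ≈⟨ +-congˡ (sum-incident e X) ⟩
    potentialOf M X + φsum X e                                     ∎
    where
    open ≈-Reasoning
    fromℕ-bit : ∀ t x → fromℕ (bit t) * x ≈ [ t ]· x
    fromℕ-bit true x = ≈-trans (*-congʳ (+-identityʳ 1#)) (*-identityˡ x)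
    fromℕ-bit false x = zeroˡ x
    pointwise : ∀ v → fromℕ (deg (M ∪ ⁅ e ⁆) v) * X v ≈ fromℕ (deg M v) * X v + [ incident e v ]· X v
    pointwise v = ≈-trans (*-congʳ (≈-trans (≈-reflexive (cong fromℕ (deg-insert≡ M e v e∉M))) (fromℕ-+ (deg M v) (bit (incident e v)))))
                  (≈-trans (distribʳ (X v) _ _) (+-congˡ (fromℕ-bit (incident e v) (X v))))

  potentialOf-monoʳ : ∀ M {X Y : Potentials} → (∀ v → X v ≤ Y v) → potentialOf M X ≤ potentialOf M Y
  potentialOf-monoʳ M X≤Y = sum-mono (λ v → *-monoʳ-≤ _ (fromℕ-nonneg (deg M v)) (X≤Y v))

  potentialOf-nonneg : ∀ M {X : Potentials} → (∀ v → 0# ≤ X v) → 0# ≤ potentialOf M X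
  potentialOf-nonneg M 0≤X = sum-nonneg (λ v → *-nonneg (fromℕ-nonneg (deg M v)) (0≤X v))

  -- If an endpoint v₀ of e is saturated by M (deg_M v₀ ≥ b_v₀), pushing e
  -- raises the potential of M by at least the excess of e:
  -- deg_M(v₀) * excess / b_v₀ ≥ excess.
  saturated-endpoint : ∀ {e L} → Valid (e ∷ L) → ∀ M v₀ → incident e v₀ ≡ true → b v₀ ℕ.≤ deg M v₀ →
                       potentialOf M (Φ L) + excess e L ≤ potentialOf M (Φ (e ∷ L))
  saturated-endpoint {e} {L} V M v₀ inc saturated = begin
    potentialOf M (Φ L) + excess e L
      ≤⟨ +-monoʳ-≤ _ (≤-trans excess≤raise (term≤sum raise-nonneg v₀)) ⟩
    potentialOf M (Φ L) + sum raise
      ≈⟨ ∑-distrib-+ (λ v → fromℕ (deg M v) * Φ L v) raise ⟨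
    sum (λ v → fromℕ (deg M v) * Φ L v + raise v)
      ≈⟨ sum-cong-≋ (λ v → ≈-sym (≈-trans (*-congˡ (Φ-push e L v)) (distribˡ _ _ _))) ⟩
    potentialOf M (Φ (e ∷ L))
      ∎
    where
    open ≤-Reasoning
    raise : Fin n → Carrier
    raise v = fromℕ (deg M v) * [ incident e v ]· (excess e L * bᶠ v ⁻¹)
    raise-nonneg : ∀ v → 0# ≤ raise v
    raise-nonneg v = *-nonneg (fromℕ-nonneg (deg M v)) (increment-nonneg V v)
    excess≤raise : excess e L ≤ raise v₀
    excess≤raise = begin
      excess e L                                          ≡⟨ cong (λ t → [ t ]· excess e L) inc ⟨
      [ incident e v₀ ]· excess e L                       ≈⟨ bᶠ*[]· v₀ (incident e v₀) (excess e L) ⟨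
      bᶠ v₀ * [ incident e v₀ ]· (excess e L * bᶠ v₀ ⁻¹)  ≤⟨ *-monoˡ-≤ _ (increment-nonneg V v₀) (fromℕ-mono saturated) ⟩
      raise v₀                                            ∎

  keptGain : List (Fin m) → Subset m → Carrier
  keptGain [] A = 0#
  keptGain (e ∷ L) A = [ ⌊ e SubsetProperties.∈? A ⌋ ]· gain e L + keptGain L A

  -- Popping e ∈ L: if e is kept, its excess plus its endpoint potentials
  -- is exactly its gain; if it is rejected, a saturated endpoint absorbs
  -- its excess.  Either way the invariant of excess-charged is preserved.
  charge-admitted : ∀ {e L} M Mfin → Valid (e ∷ L) → e ∉ M → e ∈ Mfin →
    totalExcess L ≤ keptGain L Mfin + potentialOf (M ∪ ⁅ e ⁆) (Φ L) →
    totalExcess (e ∷ L) ≤ keptGain (e ∷ L) Mfin + potentialOf M (Φ (e ∷ L))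
  charge-admitted {e} {L} M Mfin V e∉M e∈Mfin charged = begin
    excess e L + totalExcess L                        ≤⟨ +-monoʳ-≤ _ charged ⟩
    excess e L + (kept + potentialOf (M ∪ ⁅ e ⁆) (Φ L)) ≈⟨ +-congˡ (+-congˡ (potentialOf-insert M e (Φ L) e∉M)) ⟩
    excess e L + (kept + (potentialOf M (Φ L) + s))   ≤⟨ +-monoʳ-≤ _ (+-monoʳ-≤ _ (+-mono-≤ s (potentialOf-monoʳ M (Φ-grows V)))) ⟩
    excess e L + (kept + (potentialOf M (Φ (e ∷ L)) + s))
                                                      ≈⟨ +-Solver.solve 4 (λ x k p s → x ⊕ (k ⊕ (p ⊕ s)) ⊜ ((x ⊕ s) ⊕ k) ⊕ p) ≈-refl _ _ _ _ ⟩
    ((excess e L + s) + kept) + potentialOf M (Φ (e ∷ L))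
                                                      ≈⟨ +-congʳ (+-cong (≈-trans (x-y+y≈x (gain e L) s) (≈-sym kept-e)) ≈-refl) ⟩
    keptGain (e ∷ L) Mfin + potentialOf M (Φ (e ∷ L)) ∎
    where
    open ≤-Reasoning
    open +-Solver using (_⊕_; _⊜_)
    s = φsum (Φ L) e
    kept = keptGain L Mfin
    kept-e : [ ⌊ e SubsetProperties.∈? Mfin ⌋ ]· gain e L ≈ gain e L
    kept-e with e SubsetProperties.∈? Mfin
    ... | yes _ = ≈-refl
    ... | no e∉Mfin = ⊥-elim (e∉Mfin e∈Mfin)

  charge-rejected : ∀ {e L} M Mfin → Valid (e ∷ L) → ∀ v₀ → incident e v₀ ≡ true → b v₀ ℕ.≤ deg M v₀ →
    totalExcess L ≤ keptGain L Mfin + potentialOf M (Φ L) →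
    totalExcess (e ∷ L) ≤ keptGain (e ∷ L) Mfin + potentialOf M (Φ (e ∷ L))
  charge-rejected {e} {L} M Mfin V v₀ inc saturated charged = begin
    excess e L + totalExcess L                        ≤⟨ +-monoʳ-≤ _ charged ⟩
    excess e L + (kept + potentialOf M (Φ L))        ≈⟨ +-Solver.solve 3 (λ x k p → x ⊕ (k ⊕ p) ⊜ k ⊕ (p ⊕ x)) ≈-refl _ _ _ ⟩
    kept + (potentialOf M (Φ L) + excess e L)        ≤⟨ +-monoʳ-≤ kept (saturated-endpoint V M v₀ inc saturated) ⟩
    kept + potentialOf M (Φ (e ∷ L))                 ≤⟨ +-mono-≤ _ (≤-respˡ-≈ (+-identityˡ kept) (+-mono-≤ kept kept-e-nonneg)) ⟩
    keptGain (e ∷ L) Mfin + potentialOf M (Φ (e ∷ L)) ∎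
    where
    open ≤-Reasoning
    open +-Solver using (_⊕_; _⊜_)
    kept = keptGain L Mfin
    kept-e-nonneg : 0# ≤ [ ⌊ e SubsetProperties.∈? Mfin ⌋ ]· gain e L
    kept-e-nonneg = []·-nonneg _ (marginal-nonneg _ e)

  excess-charged : ∀ {L} → Valid L → ∀ M → (∀ x → x ∈ₗ L → x ∉ M) →
                   totalExcess L ≤ keptGain L (postProcess b L M) + potentialOf M (Φ L)
  excess-charged empty M _ = ≤-respʳ-≈ (≈-sym (+-identityˡ _)) (potentialOf-nonneg M (λ _ → ≤-refl))
  excess-charged {e ∷ L} V@(pushed below _ V′) M disjoint with admits M e in ok
  ... | true = charge-admitted M _ V (disjoint e (here refl)) e∈output
                 (excess-charged V′ (M ∪ ⁅ e ⁆) disjoint′)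
    where
    e∈output : e ∈ postProcess b L (M ∪ ⁅ e ⁆)
    e∈output = ⊆-postProcess L (M ∪ ⁅ e ⁆) (SubsetProperties.q⊆p∪q M ⁅ e ⁆ (SubsetProperties.x∈⁅x⁆ e))
    disjoint′ : ∀ x → x ∈ₗ L → x ∉ M ∪ ⁅ e ⁆
    disjoint′ x x∈L x∈ with SubsetProperties.x∈p∪q⁻ M ⁅ e ⁆ x∈
    ... | inj₁ x∈M = disjoint x (there x∈L) x∈M
    ... | inj₂ x∈⁅e⁆ = FinProperties.<-irrefl (SubsetProperties.x∈⁅y⁆⇒x≡y e x∈⁅e⁆) (All.lookup below x∈L)
  ... | false = charge-rejected M _ V v₀ inc saturated (excess-charged V′ M (λ x x∈L → disjoint x (there x∈L)))
    where
    saturated-witness : Σ[ v ∈ Fin n ] incident e v ≡ true × b v ℕ.≤ deg M v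
    saturated-witness = rejected⇒saturated M e (subst T ok)
    v₀ = proj₁ saturated-witness
    inc = proj₁ (proj₂ saturated-witness)
    saturated = proj₂ (proj₂ saturated-witness)

  below⇒before : ∀ {e L} → All (Fin._< e) L → toSet L ⊆ before e
  below⇒before {e} {L} below {x} x∈L =
    lookup⇒[]= x (before e) (trans (lookup∘tabulate (λ x → ⌊ x Fin.<? e ⌋) x)
                            (trans (isYes≗does (x Fin.<? e)) (dec-true (x Fin.<? e) (All.lookup below (∈-toSet⁻ L x∈L)))))

  kept-value : ∀ {L} → Valid L → ∀ A → f ⊥ + keptGain L A ≤ f (A ∩ toSet L)
  kept-value empty A = ≤-respˡ-≈ (≈-sym (+-identityʳ _)) (mono _ _ SubsetProperties.⊥⊆)
  kept-value {e ∷ L} (pushed below _ V) A with e SubsetProperties.∈? A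
  ... | no _ = ≤-respˡ-≈ (+-congˡ (≈-sym (+-identityˡ _)))
                 (≤-trans (kept-value V A) (mono _ _ (∩-monoʳ (SubsetProperties.q⊆p∪q ⁅ e ⁆ (toSet L)))))
  ... | yes e∈A = begin
    f ⊥ + (gain e L + keptGain L A)                ≈⟨ +-Solver.solve 3 (λ z g k → z ⊕ (g ⊕ k) ⊜ (z ⊕ k) ⊕ g) ≈-refl _ _ _ ⟩
    (f ⊥ + keptGain L A) + gain e L                ≤⟨ +-mono₂-≤ (kept-value V A) (marginal-antitone e A∩L⊆L∩before) ⟩
    f (A ∩ toSet L) + marginal (A ∩ toSet L) e     ≈⟨ f-insert (A ∩ toSet L) e ⟨
    f ((A ∩ toSet L) ∪ ⁅ e ⁆)                      ≤⟨ mono _ _ insert⊆ ⟩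
    f (A ∩ (⁅ e ⁆ ∪ toSet L))                      ∎
    where
    open ≤-Reasoning
    open +-Solver using (_⊕_; _⊜_)
    A∩L⊆L∩before : A ∩ toSet L ⊆ toSet L ∩ before e
    A∩L⊆L∩before x∈ = let x∈L = SubsetProperties.p∩q⊆q A (toSet L) x∈
                      in SubsetProperties.x∈p∩q⁺ (x∈L , below⇒before below x∈L)
    insert⊆ : (A ∩ toSet L) ∪ ⁅ e ⁆ ⊆ A ∩ (⁅ e ⁆ ∪ toSet L)
    insert⊆ x∈ with SubsetProperties.x∈p∪q⁻ (A ∩ toSet L) ⁅ e ⁆ x∈
    ... | inj₁ x∈A∩L = ∩-monoʳ (SubsetProperties.q⊆p∪q ⁅ e ⁆ (toSet L)) x∈A∩L
    ... | inj₂ x∈⁅e⁆ rewrite SubsetProperties.x∈⁅y⁆⇒x≡y e x∈⁅e⁆ =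
      SubsetProperties.x∈p∩q⁺ (e∈A , SubsetProperties.x∈p∪q⁺ (inj₁ (SubsetProperties.x∈⁅x⁆ e)))

  listSum : List (Fin m) → (Fin m → Carrier) → Carrier
  listSum [] h = 0#
  listSum (e ∷ L) h = h e + listSum L h

  listSum-mono : ∀ L {h h′ : Fin m → Carrier} → (∀ e → e ∈ₗ L → h e ≤ h′ e) → listSum L h ≤ listSum L h′
  listSum-mono [] _ = ≤-refl
  listSum-mono (e ∷ L) h≤h′ = +-mono₂-≤ (h≤h′ e (here refl)) (listSum-mono L (λ x x∈L → h≤h′ x (there x∈L)))

  listSum-* : ∀ L c (h : Fin m → Carrier) → listSum L (λ e → c * h e) ≈ c * listSum L h
  listSum-* [] c h = ≈-sym (zeroʳ c)
  listSum-* (e ∷ L) c h = ≈-trans (+-congˡ (listSum-* L c h)) (≈-sym (distribˡ c _ _))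

  union-bound : ∀ A L → f (A ∪ toSet L) ≤ f A + listSum L (marginal A)
  union-bound A [] = ≤-reflexive (≈-trans (≈-reflexive (cong f (SubsetProperties.∪-identityʳ A))) (≈-sym (+-identityʳ _)))
  union-bound A (e ∷ L) = begin
    f (A ∪ (⁅ e ⁆ ∪ toSet L))                            ≡⟨ cong f (reorder A ⁅ e ⁆ (toSet L)) ⟩
    f ((A ∪ toSet L) ∪ ⁅ e ⁆)                            ≈⟨ f-insert (A ∪ toSet L) e ⟩
    f (A ∪ toSet L) + marginal (A ∪ toSet L) e           ≤⟨ +-mono₂-≤ (union-bound A L) (marginal-antitone e (SubsetProperties.p⊆p∪q (toSet L))) ⟩
    (f A + listSum L (marginal A)) + marginal A e        ≈⟨ +-Solver.solve 3 (λ a l x → (a ⊕ l) ⊕ x ⊜ a ⊕ (x ⊕ l)) ≈-refl _ _ _ ⟩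
    f A + listSum (e ∷ L) (marginal A)                   ∎
    where
    open ≤-Reasoning
    open +-Solver using (_⊕_; _⊜_)
    reorder : ∀ (P Q R : Subset m) → P ∪ (Q ∪ R) ≡ (P ∪ R) ∪ Q
    reorder P Q R = trans (cong (P ∪_) (SubsetProperties.∪-comm Q R)) (sym (SubsetProperties.∪-assoc P R Q))

  listSum-φsum : ∀ {L} → Unique L → ∀ X → listSum L (φsum X) ≈ potentialOf (toSet L) X
  listSum-φsum {[]} [] X = ≈-sym (potentialOf-⊥ X)
  listSum-φsum {e ∷ L} (e∉L ∷ unique) X = begin
    φsum X e + listSum L (φsum X)            ≈⟨ +-comm _ _ ⟩
    listSum L (φsum X) + φsum X e            ≈⟨ +-congʳ (listSum-φsum unique X) ⟩
    potentialOf (toSet L) X + φsum X e       ≈⟨ potentialOf-insert (toSet L) e X e∉toSet ⟨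
    potentialOf (toSet L ∪ ⁅ e ⁆) X          ≡⟨ cong (λ M → potentialOf M X) (SubsetProperties.∪-comm (toSet L) ⁅ e ⁆) ⟩
    potentialOf (⁅ e ⁆ ∪ toSet L) X          ∎
    where
    open ≈-Reasoning
    e∉toSet : e ∉ toSet L
    e∉toSet e∈ = All.lookup e∉L (∈-toSet⁻ L e∈) refl

  -- The potentials left by the run pay for any b-matching OPT:
  -- f(OPT) ≤ f(S) + Σ_{e ∈ OPT} f_S(e) ≤ f(S) + C Σ_{e ∈ OPT} φ(e) ≤ f(S) + C Σ_v b_v φ_v.
  opt-bound : ∀ {S} → Outcome (allFin m) [] S → ∀ OPT → IsBMatching b OPT →
              f OPT ≤ f (toSet S) + C * sum (λ v → bᶠ v * Φ S v)
  opt-bound {S} outcome OPT OPT-bmatching = begin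
    f OPT                                                 ≤⟨ mono _ _ OPT⊆S∪Lopt ⟩
    f (toSet S ∪ toSet Lopt)                              ≤⟨ union-bound (toSet S) Lopt ⟩
    f (toSet S) + listSum Lopt (marginal (toSet S))       ≤⟨ +-monoʳ-≤ _ (listSum-mono Lopt (λ e _ → covered e (∈-allFin e))) ⟩
    f (toSet S) + listSum Lopt (λ e → C * φsum (Φ S) e)   ≈⟨ +-congˡ (listSum-* Lopt C (φsum (Φ S))) ⟩
    f (toSet S) + C * listSum Lopt (φsum (Φ S))           ≈⟨ +-congˡ (*-congˡ (listSum-φsum Lopt-unique (Φ S))) ⟩
    f (toSet S) + C * potentialOf (toSet Lopt) (Φ S)      ≤⟨ +-monoʳ-≤ _ (*-monoʳ-≤ C 0≤C within-capacity) ⟩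
    f (toSet S) + C * sum (λ v → bᶠ v * Φ S v)            ∎
    where
    open ≤-Reasoning
    open Outcome outcome
    Lopt : List (Fin m)
    Lopt = filter (SubsetProperties._∈? OPT) (allFin m)
    Lopt-unique : Unique Lopt
    Lopt-unique = UniqueProperties.filter⁺ (SubsetProperties._∈? OPT) (UniqueProperties.allFin⁺ m)
    OPT⊆S∪Lopt : OPT ⊆ toSet S ∪ toSet Lopt
    OPT⊆S∪Lopt {x} x∈ = SubsetProperties.q⊆p∪q (toSet S) (toSet Lopt)
                          (∈-toSet⁺ Lopt (∈-filter⁺ (SubsetProperties._∈? OPT) (∈-allFin x) x∈))
    Lopt⊆OPT : toSet Lopt ⊆ OPT
    Lopt⊆OPT x∈ = proj₂ (∈-filter⁻ (SubsetProperties._∈? OPT) {xs = allFin m} (∈-toSet⁻ Lopt x∈))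
    within-capacity : potentialOf (toSet Lopt) (Φ S) ≤ sum (λ v → bᶠ v * Φ S v)
    within-capacity = sum-mono (λ v → *-monoˡ-≤ _ (Φ-nonneg valid v)
                        (fromℕ-mono (ℕProperties.≤-trans (deg-mono Lopt⊆OPT v) (OPT-bmatching v))))

  K : Carrier
  K = (1# + 1#) * C + ratio

  2*C≈C+C : (1# + 1#) * C ≈ C + C
  2*C≈C+C = ≈-trans (distribʳ C 1# 1#) (+-cong (*-identityˡ C) (*-identityˡ C))

  1≤K : 1# ≤ K
  1≤K = ≤-trans 1≤C (≤-trans (x≤x+y 0≤C) (≤-trans (≤-reflexive (≈-sym 2*C≈C+C)) (x≤x+y 0≤ratio)))

  opt-excess-bound : ∀ {S} → Outcome (allFin m) [] S → ∀ OPT → IsBMatching b OPT →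
                     f OPT ≤ f ⊥ + K * totalExcess S
  opt-excess-bound {S} outcome OPT OPT-bmatching = begin
    f OPT                                              ≤⟨ opt-bound outcome OPT OPT-bmatching ⟩
    f (toSet S) + C * sum (λ v → bᶠ v * Φ S v)         ≈⟨ +-congˡ (*-congˡ (potential-mass S)) ⟩
    f (toSet S) + C * (D + D)                          ≤⟨ +-mono-≤ _ (stack-value (Outcome.valid outcome)) ⟩
    (f ⊥ + ratio * D) + C * (D + D)                    ≈⟨ +-assoc _ _ _ ⟩
    f ⊥ + (ratio * D + C * (D + D))                    ≈⟨ +-congˡ collect ⟩
    f ⊥ + K * D                                        ∎
    where
    open ≤-Reasoning
    D = totalExcess S
    collect : ratio * D + C * (D + D) ≈ K * D
    collect = ≈-trans (+-comm _ _) (≈-sym (≈-trans (distribʳ D _ _) (+-congʳ 2C*D≈C*[D+D])))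
      where
      2C*D≈C*[D+D] : ((1# + 1#) * C) * D ≈ C * (D + D)
      2C*D≈C*[D+D] = ≈-trans (*-congʳ 2*C≈C+C)
                     (≈-trans (distribʳ D C C) (≈-sym (distribˡ C D D)))

  -- f(∅) + K * totalExcess S ≤ K * f(M) for the output M, since the excess
  -- is charged to the gains of the kept edges.
  output-value : SetFunctions.NonNegative F f → ∀ {S} → Valid S → f ⊥ + K * totalExcess S ≤ K * f (output S)
  output-value nonneg {S} V = begin
    f ⊥ + K * totalExcess S                ≤⟨ +-monoʳ-≤ _ (*-monoʳ-≤ K 0≤K excess≤kept) ⟩
    f ⊥ + K * keptGain S M                 ≤⟨ +-mono-≤ _ (x≤k*x 1≤K (nonneg ⊥)) ⟩
    K * f ⊥ + K * keptGain S M             ≈⟨ distribˡ K _ _ ⟨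
    K * (f ⊥ + keptGain S M)               ≤⟨ *-monoʳ-≤ K 0≤K (kept-value V M) ⟩
    K * f (M ∩ toSet S)                    ≤⟨ *-monoʳ-≤ K 0≤K (mono _ _ (SubsetProperties.p∩q⊆p M (toSet S))) ⟩
    K * f M                                ∎
    where
    open ≤-Reasoning
    M = output S
    0≤K : 0# ≤ K
    0≤K = ≤-trans 0≤1 1≤K
    excess≤kept : totalExcess S ≤ keptGain S M
    excess≤kept = ≤-respʳ-≈ (≈-trans (+-congˡ (potentialOf-⊥ (Φ S))) (+-identityʳ _))
                            (excess-charged V ⊥ (λ _ _ → SubsetProperties.∉⊥))

  approximation : SetFunctions.NonNegative F f → ∀ {S φ} → Run S φ → ∀ OPT → IsBMatching b OPT →
                  f OPT ≤ K * f (output S)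
  approximation nonneg run OPT OPT-bmatching =
    ≤-trans (opt-excess-bound outcome OPT OPT-bmatching) (output-value nonneg (Outcome.valid outcome))
    where
    outcome = run-outcome run

-- The output is a b-matching, and the approximation bound even holds
-- against every b-matching OPT, in particular a maximum-value one.
theorem4p1 : (F : OrderedField) → let open OrderedField F in
    ∀ {n m : ℕ} (ends : Fin m → Fin n × Fin n) → Graph.IsSimpleGraph ends →
    (b : Fin n → ℕ) → (∀ v → 0 < b v) →
    (f : Subset m → Carrier) →
    SetFunctions.NonNegative F f → SetFunctions.Monotone F f → SetFunctions.Submodular F f →
    (C : Carrier) → 1# <ᶠ C →
    (S : List (Fin m)) (φ : MSbM.Potentials F ends b f C) →
    MSbM.Run F ends b f C S φ →
    Graph.IsBMatching ends b (MSbM.output F ends b f C S) ×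
    ((OPT : Subset m) → MSbM.IsMaxBMatching F ends b f C OPT →
      f OPT ≤ ((1# + 1#) * C + C * (C - 1#) ⁻¹) * f (MSbM.output F ends b f C S))
theorem4p1 F ends (loopless , _) b b-pos f nonneg mono submod C 1<C S φ run =
  GraphProperties.PostProcessing.output-bmatching ends b S ,
  λ OPT (OPT-bmatching , _) →
    MSbMAnalysis.approximation F ends loopless b b-pos f mono submod C 1<C nonneg run OPT OPT-bmatching
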